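{- In each of the two deduction systems DBL and DBL$_\ast$, for all formulas $\phi,\psi,\eta\in\mathcal{L}$ the sequent $\phi\times\eta,\ \psi\times\eta,\ (\phi\wedge\eta)\rightarrow(\psi\wedge\eta)\ \vdash\ \neg\eta,\ \phi\rightarrow\psi$ is derivable.
   Context: Fix a finite set $\Theta$ of atomic propositions and a distinguished $\theta_1\in\Theta$. The language $\mathcal{L}$ is the smallest set containing $\Theta$ such that $\neg\phi$, $\phi\rightarrow\psi$ and $(\psi|\phi)$ belong to $\mathcal{L}$ whenever $\phi,\psi\in\mathcal{L}$. Abbreviations: $\phi\vee\psi:=\neg\phi\rightarrow\psi$, $\phi\wedge\psi:=\neg(\neg\phi\vee\neg\psi)$, $\phi\leftrightarrow\psi:=(\phi\rightarrow\psi)\wedge(\psi\rightarrow\phi)$, $\psi\times\phi:=(\psi|\phi)\leftrightarrow\psi$, $\top:=\theta_1\rightarrow\theta_1$, $\bot:=\neg\top$. A sequent is a pair of finite (possibly empty) sequences $\Gamma,\Delta$ of formulas of $\mathcal{L}$, written $\Gamma\vdash\Delta$ (the right side lists alternatives: it is not the same as a single disjunction); "$\Gamma,\Delta$" denotes concatenation and $\{\Gamma\}$ the set of entries of $\Gamma$. The systems DBL and DBL$_\ast$ are the smallest sets of sequents $X$ satisfying, for all $\phi,\psi,\eta\in\mathcal{L}$ and finite sequences $\Gamma,\Delta,\Lambda,\Sigma$: (CUT) if $\Gamma\vdash\Delta,\phi$ and $\Lambda,\phi\vdash\Sigma$ are in $X$ then $\Gamma,\Lambda\vdash\Delta,\Sigma$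 is in $X$; (STRUCT) if $\{\Gamma\}\subset\{\Lambda\}\cup\{\top\}$, $\{\Delta\}\subset\{\Sigma\}\cup\{\bot\}$ and $\Gamma\vdash\Delta$ is in $X$ then $\Lambda\vdash\Sigma$ is in $X$; (modus ponens) $\phi,\phi\rightarrow\psi\vdash\psi$; (c1) $\vdash\phi\rightarrow(\psi\rightarrow\phi)$; (c2) $\vdash(\eta\rightarrow(\phi\rightarrow\psi))\rightarrow((\eta\rightarrow\phi)\rightarrow(\eta\rightarrow\psi))$; (c3) $\vdash(\neg\phi\rightarrow\neg\psi)\rightarrow((\neg\phi\rightarrow\psi)\rightarrow\phi)$; (b1) $\phi\rightarrow\psi\vdash\neg\phi,(\psi|\phi)$; (b2) $\vdash(\psi\rightarrow\eta|\phi)\rightarrow((\psi|\phi)\rightarrow(\eta|\phi))$; (b3) $\vdash(\psi|\phi)\rightarrow(\phi\rightarrow\psi)$; (b4) $\vdash\neg(\neg\psi|\phi)\leftrightarrow(\psi|\phi)$. DBL additionally contains (b5) $\psi\times\phi\vdash\phi\times\psi$. DBL$_\ast$ instead additionally contains (b5.weak.A) $\psi\times\neg\phi\vdash\psi\times\phi$ and $\psi\times\phi\vdash\psi\times\neg\phi$, and (b5.weak.B) $\psi\leftrightarrow\eta\vdash(\phi|\psi)\leftrightarrow(\phi|\eta)$. A sequent is derivable if it belongs to the system. -}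

module Defs where

open import Data.Nat using (ℕ)
open import Data.Fin using (Fin; zero)
open import Data.List using (List; []; _∷_; _++_; [_])
open import Data.List.Membership.Propositional using (_∈_)
open import Data.Sum using (_⊎_)
open import Relation.Binary.PropositionalEquality using (_≡_)

-- The finite set Θ of atomic propositions is Fin (suc n) (nonempty, since
-- it contains the distinguished θ₁, which we take to be zero).
module Logic (n : ℕ) where

  infixr 5 _⇒_

  data Formula : Set where
    atom : Fin (ℕ.suc n) → Formula
    ¬_   : Formula → Formula
    _⇒_  : Formula → Formula → Formula
    -- cond ψ φ  is  (ψ | φ)
    cond : Formula → Formula → Formula

  θ₁ : Formula
  θ₁ = atom zero

  _∨_ : Formula → Formula → Formula
  φ ∨ ψ = (¬ φ) ⇒ ψ

  _∧_ : Formula → Formula → Formula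
  φ ∧ ψ = ¬ ((¬ φ) ∨ (¬ ψ))

  _⇔_ : Formula → Formula → Formula
  φ ⇔ ψ = (φ ⇒ ψ) ∧ (ψ ⇒ φ)

  _⊠_ : Formula → Formula → Formula
  ψ ⊠ φ = cond ψ φ ⇔ ψ

  ⊤' : Formula
  ⊤' = θ₁ ⇒ θ₁

  ⊥' : Formula
  ⊥' = ¬ ⊤'

  Seq : Set
  Seq = List Formula


  data System : Set where
    DBL DBL* : System

  data _⊢[_]_ : Seq → System → Seq → Set where
    cut : ∀ {S Γ Δ Λ Σ φ} →
          Γ ⊢[ S ] (Δ ++ [ φ ]) → (Λ ++ [ φ ]) ⊢[ S ] Σ →
          (Γ ++ Λ) ⊢[ S ] (Δ ++ Σ)
    struct : ∀ {S Γ Δ Λ Σ} →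
          (∀ {φ} → φ ∈ Γ → φ ∈ Λ ⊎ φ ≡ ⊤') →
          (∀ {φ} → φ ∈ Δ → φ ∈ Σ ⊎ φ ≡ ⊥') →
          Γ ⊢[ S ] Δ → Λ ⊢[ S ] Σ
    mp : ∀ {S φ ψ} → (φ ∷ (φ ⇒ ψ) ∷ []) ⊢[ S ] (ψ ∷ [])
    c1 : ∀ {S φ ψ} → [] ⊢[ S ] ((φ ⇒ (ψ ⇒ φ)) ∷ [])
    c2 : ∀ {S φ ψ η} →
         [] ⊢[ S ] (((η ⇒ (φ ⇒ ψ)) ⇒ ((η ⇒ φ) ⇒ (η ⇒ ψ))) ∷ [])
    c3 : ∀ {S φ ψ} →
         [] ⊢[ S ] ((((¬ φ) ⇒ (¬ ψ)) ⇒ (((¬ φ) ⇒ ψ) ⇒ φ)) ∷ [])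
    b1 : ∀ {S φ ψ} → ((φ ⇒ ψ) ∷ []) ⊢[ S ] ((¬ φ) ∷ cond ψ φ ∷ [])
    b2 : ∀ {S φ ψ η} →
         [] ⊢[ S ] ((cond (ψ ⇒ η) φ ⇒ (cond ψ φ ⇒ cond η φ)) ∷ [])
    b3 : ∀ {S φ ψ} → [] ⊢[ S ] ((cond ψ φ ⇒ (φ ⇒ ψ)) ∷ [])
    b4 : ∀ {S φ ψ} → [] ⊢[ S ] (((¬ cond (¬ ψ) φ) ⇔ cond ψ φ) ∷ [])
    b5 : ∀ {φ ψ} → ((ψ ⊠ φ) ∷ []) ⊢[ DBL ] ((φ ⊠ ψ) ∷ [])
    b5wA₁ : ∀ {φ ψ} → ((ψ ⊠ (¬ φ)) ∷ []) ⊢[ DBL* ] ((ψ ⊠ φ) ∷ [])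
    b5wA₂ : ∀ {φ ψ} → ((ψ ⊠ φ) ∷ []) ⊢[ DBL* ] ((ψ ⊠ (¬ φ)) ∷ [])
    b5wB : ∀ {φ ψ η} →
           ((ψ ⇔ η) ∷ []) ⊢[ DBL* ] ((cond φ ψ ⇔ cond φ η) ∷ [])

{-# OPTIONS --safe #-}
-- Classically (φ ∧ η) → (ψ ∧ η)
-- gives η → (φ → ψ), which (b1) turns into ¬η or (φ → ψ | η). In the second case
-- (b2) yields (φ | η) → (ψ | η), and φ × η, ψ × η convert this into φ → ψ.
-- The classical reasoning is done in a Hilbert calculus with hypotheses, where
-- the deduction theorem holds, and then transported to sequents by CUT and STRUCT.
module Submission where

open import Defs
open import Data.Nat using (ℕ)
open import Data.List using ([]; _∷_; _++_; [_])
open import Data.List.Membership.Propositional using (_∈_)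
open import Data.List.Membership.Propositional.Properties using (∈-++⁻)
open import Data.List.Relation.Binary.Subset.Propositional using (_⊆_)
open import Data.List.Relation.Unary.Any using (here; there)
open import Data.Sum using (inj₁; reduce)
open import Relation.Binary.PropositionalEquality using (refl)

module Derivations (n : ℕ) (S : Logic.System n) where
  open Logic n

  private variable
    Γ Δ Λ : Seq
    A B φ ψ η : Formula

  ⊢-mono : Γ ⊆ Λ → Γ ⊢[ S ] Δ → Λ ⊢[ S ] Δ
  ⊢-mono Γ⊆Λ = struct (λ p → inj₁ (Γ⊆Λ p)) inj₁

  ⊢-contract : (Γ ++ Γ) ⊢[ S ] Δ → Γ ⊢[ S ] Δ
  ⊢-contract {Γ} = ⊢-mono (λ p → reduce (∈-++⁻ Γ p))

  ⇒-elim : Γ ⊢[ S ] [ A ⇒ B ] → Γ ⊢[ S ] [ A ] → Γ ⊢[ S ] [ B ]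
  ⇒-elim {A = A} A⇒B ⊢A = ⊢-contract (cut {Δ = []} ⊢A (cut {Δ = []} {Λ = [ A ]} A⇒B mp))

  ⇒-refl : [] ⊢[ S ] [ A ⇒ A ]
  ⇒-refl {A} = ⇒-elim (⇒-elim (c2 {φ = A ⇒ A}) c1) (c1 {ψ = A})

  ⊢-identity : [ A ] ⊢[ S ] [ A ]
  ⊢-identity {A} = cut {Δ = []} {Λ = [ A ]} ⇒-refl mp

  infix 3 _⊢ʰ_
  infixl 5 _·_

  data _⊢ʰ_ (Γ : Seq) : Formula → Set where
    assume  : A ∈ Γ → Γ ⊢ʰ A
    theorem : [] ⊢[ S ] [ A ] → Γ ⊢ʰ A
    _·_     : Γ ⊢ʰ A ⇒ B → Γ ⊢ʰ A → Γ ⊢ʰ B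

  sound : Γ ⊢ʰ A → Γ ⊢[ S ] [ A ]
  sound (assume A∈Γ) = ⊢-mono (λ { (here refl) → A∈Γ }) ⊢-identity
  sound (theorem ⊢A) = ⊢-mono (λ ()) ⊢A
  sound (d · e)      = ⇒-elim (sound d) (sound e)

  ⊢ʰ-mono : Γ ⊆ Λ → Γ ⊢ʰ A → Λ ⊢ʰ A
  ⊢ʰ-mono Γ⊆Λ (assume A∈Γ) = assume (Γ⊆Λ A∈Γ)
  ⊢ʰ-mono Γ⊆Λ (theorem ⊢A) = theorem ⊢A
  ⊢ʰ-mono Γ⊆Λ (d · e)      = ⊢ʰ-mono Γ⊆Λ d · ⊢ʰ-mono Γ⊆Λ e

  weaken : Γ ⊢ʰ A → B ∷ Γ ⊢ʰ A
  weaken = ⊢ʰ-mono there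

  deduction : A ∷ Γ ⊢ʰ B → Γ ⊢ʰ A ⇒ B
  deduction (assume (here refl)) = theorem ⇒-refl
  deduction (assume (there B∈Γ)) = theorem c1 · assume B∈Γ
  deduction (theorem ⊢B)         = theorem c1 · theorem ⊢B
  deduction (d · e)              = theorem c2 · deduction d · deduction e

  by-contradiction : ¬ A ∷ Γ ⊢ʰ B → ¬ A ∷ Γ ⊢ʰ ¬ B → Γ ⊢ʰ A
  by-contradiction B ¬B = theorem c3 · deduction ¬B · deduction B

  ¬¬-elim : Γ ⊢ʰ ¬ ¬ A → Γ ⊢ʰ A
  ¬¬-elim ¬¬A = by-contradiction (assume (here refl)) (weaken ¬¬A)

  ¬¬-intro : Γ ⊢ʰ A → Γ ⊢ʰ ¬ ¬ A
  ¬¬-intro ⊢A = by-contradiction (weaken ⊢A) (¬¬-elim (assume (here refl)))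

  contradiction : Γ ⊢ʰ A → Γ ⊢ʰ ¬ A → Γ ⊢ʰ B
  contradiction ⊢A ¬A = by-contradiction (weaken ⊢A) (weaken ¬A)

  ∧-intro : Γ ⊢ʰ A → Γ ⊢ʰ B → Γ ⊢ʰ A ∧ B
  ∧-intro ⊢A ⊢B =
    by-contradiction (weaken ⊢B) (¬¬-elim (assume (here refl)) · ¬¬-intro (weaken ⊢A))

  ∧-elimˡ : Γ ⊢ʰ A ∧ B → Γ ⊢ʰ A
  ∧-elimˡ {A = A} {B = B} A∧B = by-contradiction {B = ¬ ¬ A ⇒ ¬ B}
    (deduction (contradiction (assume (there (here refl))) (assume (here refl))))
    (weaken A∧B)

  ∧-elimʳ : Γ ⊢ʰ A ∧ B → Γ ⊢ʰ B
  ∧-elimʳ {A = A} {B = B} A∧B = by-contradiction {B = ¬ ¬ A ⇒ ¬ B}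
    (theorem c1 · assume (here refl))
    (weaken A∧B)

  ∧-⇒-∧-cancelʳ : Γ ⊢ʰ (φ ∧ η) ⇒ (ψ ∧ η) → Γ ⊢ʰ η ⇒ (φ ⇒ ψ)
  ∧-⇒-∧-cancelʳ φ∧η⇒ψ∧η = deduction (deduction (∧-elimˡ
    (weaken (weaken φ∧η⇒ψ∧η) · ∧-intro (assume (here refl)) (assume (there (here refl))))))

  ⊠-cond-⇒ : Γ ⊢ʰ φ ⊠ η → Γ ⊢ʰ ψ ⊠ η → Γ ⊢ʰ cond (φ ⇒ ψ) η → Γ ⊢ʰ φ ⇒ ψ
  ⊠-cond-⇒ φ×η ψ×η [φ⇒ψ∣η] = deduction (∧-elimˡ (weaken ψ×η)
    · (theorem b2 · weaken [φ⇒ψ∣η] · (∧-elimʳ (weaken φ×η) · assume (here refl))))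

mainTheorem8 : (n : ℕ) → let open Logic n in
    (S : System) → (φ ψ η : Formula) →
    ((φ ⊠ η) ∷ (ψ ⊠ η) ∷ ((φ ∧ η) ⇒ (ψ ∧ η)) ∷ []) ⊢[ S ] ((¬ η) ∷ (φ ⇒ ψ) ∷ [])
mainTheorem8 n S φ ψ η = ⊢-mono rotate (cut {Δ = [ ¬ η ]} {Λ = (φ ⊠ η) ∷ (ψ ⊠ η) ∷ []}
    (cut {Γ = [ (φ ∧ η) ⇒ (ψ ∧ η) ]} {Δ = []} {Λ = []} (sound (∧-⇒-∧-cancelʳ (assume (here refl)))) b1)
    (sound (⊠-cond-⇒ (assume (here refl)) (assume (there (here refl)))
                     (assume (there (there (here refl)))))))
  where
    open Logic n
    open Derivations n S
    rotate : ((φ ∧ η) ⇒ (ψ ∧ η)) ∷ (φ ⊠ η) ∷ (ψ ⊠ η) ∷ [] ⊆ (φ ⊠ η) ∷ (ψ ⊠ η) ∷ ((φ ∧ η) ⇒ (ψ ∧ η)) ∷ []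
    rotate (here refl)                 = there (there (here refl))
    rotate (there (here refl))         = here refl
    rotate (there (there (here refl))) = there (here refl)
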